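{- Let $r\ge 2$ and let $1\le k_1<k_2<\cdots<k_s$ be fixed integers with $k_s=2^{r-1}$. Let $P(x)$ be the characteristic polynomial of the minimal homogeneous linear recurrence with integer coefficients satisfied by the sequence $\{S_n\}_{n\in\mathbb{N}}$, where $$S_n=\sum_{j=0}^n(-1)^{\binom{j}{k_1}+\cdots+\binom{j}{k_s}}\binom{n}{j}.$$ Then $$P(x)=\Phi_{2^r}(x-1)=2+\sum_{m=1}^{2^{r-1}}(-1)^m\binom{2^{r-1}}{m}x^m.$$ In particular, $\deg P=2^{r-1}=2^{\lfloor\log_2(k_s)\rfloor}$.
   Context: $\mathbb{N}=\{1,2,3,\dots\}$. $S_n$ is the exponential sum of the symmetric Boolean function $\sigma_{n,k_1}+\cdots+\sigma_{n,k_s}$, $\sigma_{n,k}$ being the elementary symmetric polynomial of degree $k$ in $n$ variables over $\mathbb{F}_2$. $\Phi_m$ is the $m$-th cyclotomic polynomial. A homogeneous linear recurrence $x_n=\sum_{i=1}^D a_ix_{n-i}$ with $a_i\in\mathbb{Z}$ has characteristic polynomial $x^D-\sum_{i=1}^D a_ix^{D-i}$; "minimal" means of least order. -}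

module Defs where

open import Data.Nat using (ℕ; zero; suc; _+_; _∸_; _^_; _≤_; _%_)
open import Data.Nat.Combinatorics using (_C_)
open import Data.Integer using (ℤ; +_; -_) renaming (_+_ to _+ℤ_; _*_ to _*ℤ_)
open import Data.List using (List; []; _∷_; map; foldr; upTo; reverse; length; _++_)
open import Data.Product using (_×_)

sumℤ : List ℤ → ℤ
sumℤ = foldr _+ℤ_ (+ 0)

sgn : ℕ → ℤ
sgn m with m % 2
... | zero = + 1
... | suc _ = - (+ 1)

binSum : List ℕ → ℕ → ℕ
binSum ks j = foldr _+_ 0 (map (λ k → j C k) ks)

S : List ℕ → ℕ → ℤ
S ks n = sumℤ (map (λ j → sgn (binSum ks j) *ℤ (+ (n C j))) (upTo (suc n)))

recRHS : (ℕ → ℤ) → List ℤ → ℕ → ℤ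
recRHS x [] N = + 0
recRHS x (c ∷ cs) N = (c *ℤ x (N ∸ 1)) +ℤ recRHS x cs (N ∸ 1)

-- x satisfies x_n = Σ_{i=1}^{D} a_i x_{n-i} for all n ∈ ℕ = {1,2,...} with n - D ≥ 1
Satisfies : (ℕ → ℤ) → List ℤ → Set
Satisfies x a = ∀ n → 1 ≤ n → x (n + length a) ≡ recRHS x a (n + length a)
  where open import Relation.Binary.PropositionalEquality using (_≡_)

IsMinimalRecurrence : (ℕ → ℤ) → List ℤ → Set
IsMinimalRecurrence x a = Satisfies x a × (∀ b → Satisfies x b → length a ≤ length b)

-- characteristic polynomial x^D - Σ a_i x^{D-i}, as coefficient list (constant term first)
charPoly : List ℤ → List ℤ
charPoly a = reverse (map -_ a) ++ (+ 1 ∷ [])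

targetPoly : ℕ → List ℤ
targetPoly r = + 2 ∷ map (λ m → sgn (suc m) *ℤ (+ ((2 ^ (r ∸ 1)) C (suc m)))) (upTo (2 ^ (r ∸ 1)))

-- Write D = 1 + T for the shift T on integer sequences. By the binomial theorem
-- S n = (Dⁿ g) 0 with g j = (-1)^(C(j,k₁)+⋯+C(j,k_s)), so S satisfies the recurrence with
-- characteristic polynomial c iff D (c(D) g) = 0, and since D is injective on antiperiodic
-- sequences of even period, iff c(D) g = 0. For N = 2^(r-1) = k_s, the congruence
-- D^N ≡ 1 + T^N (mod 2) gives the Lucas parities C(j+N,k) ≡ C(j,k) for k < N and
-- C(j+N,N) ≡ C(j,N) + 1, so g is N-antiperiodic and P(D) = 1 + (1 - D)^N = 1 + T^N kills g.
-- Conversely P(x) = 2 + x R(x) is Eisenstein at 2. If c(D) g = 0 with deg c < N, the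
-- constant coefficient of c is even because g is odd, and P(D) = 0 on antiperiodic
-- sequences trades it for a multiple of R one degree up; after N such steps c(D) u lies in
-- D^N(antiperiodic), which is even, for every antiperiodic u. Testing against the
-- antiperiodic pulse shows that all coefficients of c are even, and halving them descends
-- on Σ|cᵢ| to c = 0. So no recurrence has order < N, and the one of order N is unique.

module Submission where

open import Data.Nat using (ℕ; _≤_; _<_; _^_; _∸_)
open import Data.Integer using (ℤ)
open import Data.List using (List; _∷ʳ_)
open import Data.List.Relation.Unary.All using (All)
open import Data.List.Relation.Unary.Linked using (Linked)
open import Data.Product using (Σ; _×_)
open import Relation.Binary.PropositionalEquality using (_≡_)

open import Defs
open import Data.Nat as ℕ using (zero; suc; z≤n; s≤s; _/_; _%_)
import Data.Nat.Properties as ℕP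
import Data.Nat.DivMod as ℕD
import Data.Nat.Divisibility as ℕ∣
open import Data.Nat.ListAction using (sum)
import Data.Nat.Tactic.RingSolver as ℕRing
open import Data.Nat.Combinatorics using (_C_; nCn≡1; nCk+nC[k+1]≡[n+1]C[k+1]; nCk≡nC[n∸k])
open import Data.Nat.Combinatorics.Specification using (k>n⇒nCk≡0)
open import Data.Integer using (+_; -[1+_]; -_; _+_; _*_; _-_; ∣_∣)
import Data.Integer.Properties as ℤP
open import Data.Integer.Divisibility.Signed
  using (_∣_; divides; _∣?_; ∣m∣n⇒∣m+n; ∣m⇒∣-m; ∣m+n∣n⇒∣m; ∣n⇒∣m*n; ∣m⇒∣m*n; ∣⇒∣ᵤ)
open import Data.Integer.Tactic.RingSolver using (solve-∀)
open import Algebra.Properties.AbelianGroup ℤP.+-0-abelianGroup using (inverseˡ-unique; inverseʳ-unique)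
open import Data.List using ([]; _∷_; map; length; upTo; applyUpTo; reverse; _++_)
import Data.List.Properties as LP
open import Data.List.Relation.Unary.All as All using ([]; _∷_; all?)
import Data.List.Relation.Unary.All.Properties as AllP
open import Data.List.Relation.Unary.Any using (Any; here; there)
open import Data.List.Relation.Unary.AllPairs using (AllPairs; []; _∷_)
open import Data.List.Relation.Unary.Linked.Properties using (Linked⇒AllPairs)
open import Data.Product using (_,_; proj₂)
open import Data.Empty using (⊥-elim)
open import Function using (_∘_)
open import Relation.Nullary using (¬_; yes; no)
open import Relation.Binary.PropositionalEquality
  using (refl; sym; trans; cong; cong₂; subst; _≗_; module ≡-Reasoning)

Even : ℤ → Set
Even = + 2 ∣_

Odd : ℤ → Set
Odd x = Even (x + + 1)

even-0 : Even (+ 0)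
even-0 = divides (+ 0) refl

even-double : ∀ x → Even (x + x)
even-double x = divides x (x+x≡x*2 x)
  where x+x≡x*2 : ∀ x → x + x ≡ x * + 2
        x+x≡x*2 = solve-∀

¬even-+-even : ∀ {x y} → ¬ Even x → Even y → ¬ Even (x + y)
¬even-+-even ¬even-x even-y even-x+y = ¬even-x (∣m+n∣n⇒∣m even-x+y even-y)

even-*-odd : ∀ c {x} → Even (c * x) → Odd x → Even c
even-*-odd c {x} even-cx odd-x =
  subst Even (split c x) (∣m∣n⇒∣m+n (∣n⇒∣m*n c odd-x) (∣m⇒∣-m even-cx))
  where split : ∀ c x → c * (x + + 1) + - (c * x) ≡ c
        split = solve-∀

sgn-suc : ∀ m → sgn (suc m) ≡ - sgn m
sgn-suc zero    = refl
sgn-suc (suc m) = trans (sym (ℤP.neg-involutive (sgn m))) (cong -_ (sym (sgn-suc m)))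

sgn-+ : ∀ a b → sgn (a ℕ.+ b) ≡ sgn a * sgn b
sgn-+ zero    b = sym (ℤP.*-identityˡ (sgn b))
sgn-+ (suc a) b = begin
  sgn (suc a ℕ.+ b)    ≡⟨ sgn-suc (a ℕ.+ b) ⟩
  - sgn (a ℕ.+ b)      ≡⟨ cong -_ (sgn-+ a b) ⟩
  - (sgn a * sgn b)    ≡⟨ ℤP.neg-distribˡ-* (sgn a) (sgn b) ⟩
  - sgn a * sgn b      ≡⟨ cong (_* sgn b) (sgn-suc a) ⟨
  sgn (suc a) * sgn b  ∎
  where open ≡-Reasoning

sgn-double : ∀ m → sgn (m ℕ.+ m) ≡ + 1
sgn-double zero    = refl
sgn-double (suc m) = trans (cong (λ n → sgn (suc n)) (ℕP.+-suc m m)) (sgn-double m)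

sgn-odd : ∀ m → Odd (sgn m)
sgn-odd zero          = divides (+ 1) refl
sgn-odd (suc zero)    = even-0
sgn-odd (suc (suc m)) = sgn-odd m

sgn-even : ∀ {n} → Even (+ n) → sgn n ≡ + 1
sgn-even 2∣n with ∣⇒∣ᵤ 2∣n
... | ℕ∣.divides q refl =
  trans (cong sgn (trans (ℕP.*-comm q 2) (cong (q ℕ.+_) (ℕP.+-identityʳ q)))) (sgn-double q)

sgn-≡-of-even-sum : ∀ a b → Even (+ a + + b) → sgn a ≡ sgn b
sgn-≡-of-even-sum a b even = begin
  sgn a                    ≡⟨ ℤP.*-identityʳ (sgn a) ⟨
  sgn a * + 1              ≡⟨ cong (sgn a *_) (trans (sym (sgn-double b)) (sgn-+ b b)) ⟩
  sgn a * (sgn b * sgn b)  ≡⟨ ℤP.*-assoc (sgn a) (sgn b) (sgn b) ⟨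
  sgn a * sgn b * sgn b    ≡⟨ cong (_* sgn b) (sym (sgn-+ a b)) ⟩
  sgn (a ℕ.+ b) * sgn b    ≡⟨ cong (_* sgn b) (sgn-even (subst Even (sym (ℤP.pos-+ a b)) even)) ⟩
  + 1 * sgn b              ≡⟨ ℤP.*-identityˡ (sgn b) ⟩
  sgn b                    ∎
  where open ≡-Reasoning

sgn-≡-neg-of-odd-sum : ∀ a b → Odd (+ a + + b) → sgn a ≡ - sgn b
sgn-≡-neg-of-odd-sum a b odd =
  trans (sgn-≡-of-even-sum a (suc b) (subst Even (shift a b) odd)) (sgn-suc b)
  where shift : ∀ a b → + a + + b + + 1 ≡ + a + + suc b
        shift a b = trans (ℤP.+-assoc (+ a) (+ b) (+ 1))
                          (cong (λ z → + a + z) (trans (ℤP.+-comm (+ b) (+ 1)) (sym (ℤP.pos-+ 1 b))))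

sgn-2^suc : ∀ e → sgn (2 ^ suc e) ≡ + 1
sgn-2^suc e = trans (cong (λ k → sgn (2 ^ e ℕ.+ k)) (ℕP.+-identityʳ (2 ^ e))) (sgn-double (2 ^ e))

Seq : Set
Seq = ℕ → ℤ

D : Seq → Seq
D u j = u j + u (suc j)

D^ : ℕ → Seq → Seq
D^ zero    u = u
D^ (suc m) u = D (D^ m u)

D-cong : ∀ {u v} → u ≗ v → D u ≗ D v
D-cong u≗v j = cong₂ _+_ (u≗v j) (u≗v (suc j))

D^-cong : ∀ m {u v} → u ≗ v → D^ m u ≗ D^ m v
D^-cong zero    u≗v = u≗v
D^-cong (suc m) u≗v = D-cong (D^-cong m u≗v)

D^-D : ∀ m u → D^ m (D u) ≗ D (D^ m u)
D^-D zero    u j = refl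
D^-D (suc m) u   = D-cong (D^-D m u)

D^-+ : ∀ a b u → D^ (a ℕ.+ b) u ≗ D^ a (D^ b u)
D^-+ zero    b u j = refl
D^-+ (suc a) b u   = D-cong (D^-+ a b u)

D^-linear : ∀ m c u v → D^ m (λ j → c * u j + v j) ≗ λ j → c * D^ m u j + D^ m v j
D^-linear zero    c u v j = refl
D^-linear (suc m) c u v j = trans (D-cong (D^-linear m c u v) j) (regroup c _ _ _ _)
  where regroup : ∀ c a a' b b' → (c * a + b) + (c * a' + b') ≡ c * (a + a') + (b + b')
        regroup = solve-∀

D^-zero : ∀ m {u} → (∀ j → u j ≡ + 0) → ∀ j → D^ m u j ≡ + 0
D^-zero zero    u≡0 j = u≡0 j
D^-zero (suc m) u≡0 j = cong₂ _+_ (D^-zero m u≡0 j) (D^-zero m u≡0 (suc j))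

even-D^ : ∀ m {u} → (∀ j → Even (u j)) → ∀ j → Even (D^ m u j)
even-D^ zero    even j = even j
even-D^ (suc m) even j = ∣m∣n⇒∣m+n (even-D^ m even j) (even-D^ m even (suc j))

D^-at-0≡0⇒≡0 : ∀ u → (∀ m → D^ m u 0 ≡ + 0) → ∀ j → u j ≡ + 0
D^-at-0≡0⇒≡0 u D^u0≡0 zero    = D^u0≡0 0
D^-at-0≡0⇒≡0 u D^u0≡0 (suc j) = cancel (D^-at-0≡0⇒≡0 u D^u0≡0 j) (D^-at-0≡0⇒≡0 (D u) D^[Du]0≡0 j)
  where
    D^[Du]0≡0 : ∀ m → D^ m (D u) 0 ≡ + 0
    D^[Du]0≡0 m = trans (D^-D m u 0) (D^u0≡0 (suc m))
    cancel : ∀ {a b} → a ≡ + 0 → a + b ≡ + 0 → b ≡ + 0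
    cancel refl a+b≡0 = trans (sym (ℤP.+-identityˡ _)) a+b≡0

evalD : List ℤ → Seq → Seq
evalD []       u j = + 0
evalD (c ∷ cs) u j = c * u j + D (evalD cs u) j

_annihilates_ : List ℤ → Seq → Set
c annihilates u = ∀ j → evalD c u j ≡ + 0

infixl 6 _⊞_

_⊞_ : List ℤ → List ℤ → List ℤ
[]      ⊞ q       = q
(a ∷ p) ⊞ []      = a ∷ p
(a ∷ p) ⊞ (b ∷ q) = (a + b) ∷ (p ⊞ q)

length-⊞-≤ : ∀ n p q → length p ≤ n → length q ≤ n → length (p ⊞ q) ≤ n
length-⊞-≤ n       []      q       p≤n q≤n             = q≤n
length-⊞-≤ n       (a ∷ p) []      p≤n q≤n             = p≤n
length-⊞-≤ (suc n) (a ∷ p) (b ∷ q) (s≤s p≤n) (s≤s q≤n) = s≤s (length-⊞-≤ n p q p≤n q≤n)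

evalD-⊞ : ∀ p q u j → evalD (p ⊞ q) u j ≡ evalD p u j + evalD q u j
evalD-⊞ []      q       u j = sym (ℤP.+-identityˡ _)
evalD-⊞ (a ∷ p) []      u j = sym (ℤP.+-identityʳ _)
evalD-⊞ (a ∷ p) (b ∷ q) u j =
  trans (cong₂ (λ x y → (a + b) * u j + (x + y)) (evalD-⊞ p q u j) (evalD-⊞ p q u (suc j)))
        (regroup a b (u j) (evalD p u j) (evalD q u j) (evalD p u (suc j)) (evalD q u (suc j)))
  where regroup : ∀ a b x p q p' q' → (a + b) * x + ((p + q) + (p' + q')) ≡ (a * x + (p + p')) + (b * x + (q + q'))
        regroup = solve-∀

evalD-scale : ∀ p a u j → evalD (map (_* a) p) u j ≡ evalD p u j * a
evalD-scale []      a u j = refl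
evalD-scale (c ∷ p) a u j =
  trans (cong₂ (λ x y → c * a * u j + (x + y)) (evalD-scale p a u j) (evalD-scale p a u (suc j)))
        (regroup c a (u j) (evalD p u j) (evalD p u (suc j)))
  where regroup : ∀ c a x p p' → c * a * x + (p * a + p' * a) ≡ (c * x + (p + p')) * a
        regroup = solve-∀

evalD-neg : ∀ p u j → evalD (map -_ p) u j ≡ - evalD p u j
evalD-neg []      u j = refl
evalD-neg (c ∷ p) u j =
  trans (cong₂ (λ x y → - c * u j + (x + y)) (evalD-neg p u j) (evalD-neg p u (suc j)))
        (regroup c (u j) (evalD p u j) (evalD p u (suc j)))
  where regroup : ∀ c x p p' → - c * x + (- p + - p') ≡ - (c * x + (p + p'))
        regroup = solve-∀

evalD-++ : ∀ p q u j → evalD (p ++ q) u j ≡ evalD p u j + D^ (length p) (evalD q u) j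
evalD-++ []      q u j = sym (ℤP.+-identityˡ _)
evalD-++ (c ∷ p) q u j =
  trans (cong₂ (λ x y → c * u j + (x + y)) (evalD-++ p q u j) (evalD-++ p q u (suc j)))
        (regroup (c * u j) (evalD p u j) (evalD p u (suc j)) (D^ (length p) (evalD q u) j) (D^ (length p) (evalD q u) (suc j)))
  where regroup : ∀ a p p' w w' → a + ((p + w) + (p' + w')) ≡ (a + (p + p')) + (w + w')
        regroup = solve-∀

D^-evalD-∷ : ∀ m c cs u j → D^ m (evalD (c ∷ cs) u) j ≡ c * D^ m u j + D^ (suc m) (evalD cs u) j
D^-evalD-∷ m c cs u j =
  trans (D^-linear m c u (D (evalD cs u)) j) (cong (_+_ (c * D^ m u j)) (D^-D m (evalD cs u) j))

Antiperiodic : ℕ → Seq → Set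
Antiperiodic N u = ∀ j → u (j ℕ.+ N) ≡ - u j

module _ {N : ℕ} where

  antiperiodic-D : ∀ {u} → Antiperiodic N u → Antiperiodic N (D u)
  antiperiodic-D {u} anti j =
    trans (cong₂ _+_ (anti j) (anti (suc j))) (sym (ℤP.neg-distrib-+ (u j) (u (suc j))))

  antiperiodic-evalD : ∀ c {u} → Antiperiodic N u → Antiperiodic N (evalD c u)
  antiperiodic-evalD []       anti j = refl
  antiperiodic-evalD (c ∷ cs) {u} anti j =
    trans (cong₂ (λ x y → c * x + y) (anti j) (antiperiodic-D (antiperiodic-evalD cs anti) j))
          (negate c (u j) (D (evalD cs u) j))
    where negate : ∀ c x y → c * - x + - y ≡ - (c * x + y)
          negate = solve-∀

x+x≡0⇒x≡0 : ∀ {x} → x + x ≡ + 0 → x ≡ + 0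
x+x≡0⇒x≡0 {+ zero}     _  = refl
x+x≡0⇒x≡0 {+ suc n}    ()
x+x≡0⇒x≡0 { -[1+ n ]} ()

D-injective-antiperiodic : ∀ M {u} → Antiperiodic (2 ℕ.* M) u → (∀ j → D u j ≡ + 0) → ∀ j → u j ≡ + 0
D-injective-antiperiodic M {u} anti Du≡0 j =
  x+x≡0⇒x≡0 (trans (cong (_+_ (u j)) (trans (sym (periodic M j)) (trans period (anti j)))) (ℤP.+-inverseʳ (u j)))
  where
    period : u (j ℕ.+ (M ℕ.+ M)) ≡ u (j ℕ.+ 2 ℕ.* M)
    period = cong (λ k → u (j ℕ.+ (M ℕ.+ k))) (sym (ℕP.+-identityʳ M))
    alternating : ∀ i → u (suc i) ≡ - u i
    alternating i = inverseʳ-unique (u i) (u (suc i)) (Du≡0 i)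
    periodic : ∀ k i → u (i ℕ.+ (k ℕ.+ k)) ≡ u i
    periodic zero    i = cong u (ℕP.+-identityʳ i)
    periodic (suc k) i = begin
      u (i ℕ.+ (suc k ℕ.+ suc k))       ≡⟨ cong (λ n → u (i ℕ.+ suc n)) (ℕP.+-suc k k) ⟩
      u (i ℕ.+ suc (suc (k ℕ.+ k)))     ≡⟨ cong u (trans (ℕP.+-suc i _) (cong suc (ℕP.+-suc i _))) ⟩
      u (suc (suc (i ℕ.+ (k ℕ.+ k))))   ≡⟨ alternating (suc _) ⟩
      - u (suc (i ℕ.+ (k ℕ.+ k)))       ≡⟨ cong -_ (alternating _) ⟩
      - - u (i ℕ.+ (k ℕ.+ k))           ≡⟨ ℤP.neg-involutive _ ⟩
      u (i ℕ.+ (k ℕ.+ k))               ≡⟨ periodic k i ⟩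
      u i                               ∎
      where open ≡-Reasoning

frobenius : ∀ e u j → Even (D^ (2 ^ e) u j - (u j + u (j ℕ.+ 2 ^ e)))
frobenius zero u j =
  subst Even (sym (trans (cong (λ i → D u j - (u j + u i)) (ℕP.+-comm j 1)) (ℤP.+-inverseʳ (D u j)))) even-0
frobenius (suc e) u j = subst (λ n → Even (D^ n u j - (u j + u (j ℕ.+ n)))) (sym 2^suc) doubling
  where
    m = 2 ^ e
    2^suc : 2 ^ suc e ≡ m ℕ.+ m
    2^suc = cong (m ℕ.+_) (ℕP.+-identityʳ m)
    telescope : ∀ x a₀ a₁ u₀ u₁ u₂ →
      (x - (a₀ + a₁)) + (a₀ - (u₀ + u₁)) + (a₁ - (u₁ + u₂)) + (u₁ + u₁) ≡ x - (u₀ + u₂)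
    telescope = solve-∀
    doubling : Even (D^ (m ℕ.+ m) u j - (u j + u (j ℕ.+ (m ℕ.+ m))))
    doubling = subst Even
      (trans (telescope (D^ m (D^ m u) j) (D^ m u j) (D^ m u (j ℕ.+ m)) (u j) (u (j ℕ.+ m)) (u (j ℕ.+ m ℕ.+ m)))
             (cong₂ (λ x i → x - (u j + u i)) (sym (D^-+ m m u j)) (ℕP.+-assoc j m m)))
      (∣m∣n⇒∣m+n (∣m∣n⇒∣m+n (∣m∣n⇒∣m+n (frobenius e (D^ m u) j) (frobenius e u j))
                               (frobenius e u (j ℕ.+ m)))
                 (even-double (u (j ℕ.+ m))))

even-D^-antiperiodic : ∀ e {u} → Antiperiodic (2 ^ e) u → ∀ j → Even (D^ (2 ^ e) u j)
even-D^-antiperiodic e {u} anti j = subst Even cancel (frobenius e u j)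
  where
    cancel : D^ (2 ^ e) u j - (u j + u (j ℕ.+ 2 ^ e)) ≡ D^ (2 ^ e) u j
    cancel = trans (cong (λ x → D^ (2 ^ e) u j - (u j + x)) (anti j))
                   (trans (cong (_-_ (D^ (2 ^ e) u j)) (ℤP.+-inverseʳ (u j))) (ℤP.+-identityʳ _))

binom : ℕ → Seq
binom k j = + (j C k)

nC0≡1 : ∀ n → n C 0 ≡ 1
nC0≡1 n = trans (nCk≡nC[n∸k] {0} {n} z≤n) (nCn≡1 n)

D-binom-suc-mod-2 : ∀ k j → Even (D (binom (suc k)) j - binom k j)
D-binom-suc-mod-2 k j = subst Even (sym (trans pascal (regroup (binom (suc k) j) (binom k j)))) (even-double (binom (suc k) j))
  where
    pascal : D (binom (suc k)) j - binom k j ≡ binom (suc k) j + (binom k j + binom (suc k) j) - binom k j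
    pascal = cong (λ z → binom (suc k) j + + z - binom k j) (sym (nCk+nC[k+1]≡[n+1]C[k+1] j k))
    regroup : ∀ a b → a + (b + a) - b ≡ a + a
    regroup = solve-∀

D^-binom-mod-2 : ∀ m k j → Even (D^ m (binom (m ℕ.+ k)) j - binom k j)
D^-binom-mod-2 zero    k j = subst Even (sym (ℤP.+-inverseʳ (binom k j))) even-0
D^-binom-mod-2 (suc m) k j =
  subst Even (telescope (X j) (X (suc j)) (binom (suc k) j) (binom (suc k) (suc j)) (binom k j))
    (∣m∣n⇒∣m+n (∣m∣n⇒∣m+n (ih j) (ih (suc j))) (D-binom-suc-mod-2 k j))
  where
    X = D^ m (binom (suc (m ℕ.+ k)))
    ih : ∀ j → Even (X j - binom (suc k) j)
    ih j = subst (λ n → Even (D^ m (binom n) j - binom (suc k) j)) (ℕP.+-suc m k) (D^-binom-mod-2 m (suc k) j)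
    telescope : ∀ x x' b b' c → (x - b) + (x' - b') + ((b + b') - c) ≡ (x + x') - c
    telescope = solve-∀

binom-periodic-mod-2 : ∀ e {k} → k < 2 ^ e → ∀ j → Even (binom k j + binom k (j ℕ.+ 2 ^ e))
binom-periodic-mod-2 e {k} k<N j =
  subst Even (cancel (D^ N (binom k) j) (binom k j + binom k (j ℕ.+ N)))
    (∣m∣n⇒∣m+n D^N-even (∣m⇒∣-m (frobenius e (binom k) j)))
  where
    N = 2 ^ e
    X = D^ k (binom k)
    D^k-binom : ∀ j → Even (X j - binom 0 j)
    D^k-binom j = subst (λ n → Even (D^ k (binom n) j - binom 0 j)) (ℕP.+-identityʳ k) (D^-binom-mod-2 k 0 j)
    D^[k+1]-even : ∀ j → Even (D^ (suc k) (binom k) j)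
    D^[k+1]-even j = subst Even (regroup (X j) (X (suc j)) (binom 0 j) (binom 0 (suc j)))
      (∣m∣n⇒∣m+n (∣m∣n⇒∣m+n (D^k-binom j) (D^k-binom (suc j)))
                 (subst Even (cong₂ (λ a b → + a + + b) (sym (nC0≡1 j)) (sym (nC0≡1 (suc j)))) (even-double (+ 1))))
      where regroup : ∀ x x' b b' → (x - b) + (x' - b') + (b + b') ≡ x + x'
            regroup = solve-∀
    D^N-even : Even (D^ N (binom k) j)
    D^N-even = subst (λ n → Even (D^ n (binom k) j)) (ℕP.m∸n+n≡m k<N)
      (subst Even (sym (D^-+ (N ℕ.∸ suc k) (suc k) (binom k) j)) (even-D^ (N ℕ.∸ suc k) D^[k+1]-even j))
    cancel : ∀ a b → a + - (a - b) ≡ b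
    cancel = solve-∀

binom-2^e-antiperiodic-mod-2 : ∀ e j → Odd (binom (2 ^ e) j + binom (2 ^ e) (j ℕ.+ 2 ^ e))
binom-2^e-antiperiodic-mod-2 e j =
  subst Even (regroup (D^ N (binom N) j) (binom N j + binom N (j ℕ.+ N)))
    (∣m∣n⇒∣m+n (∣m∣n⇒∣m+n D^N≡1 (∣m⇒∣-m (frobenius e (binom N) j))) (even-double (+ 1)))
  where
    N = 2 ^ e
    D^N≡1 : Even (D^ N (binom N) j - + 1)
    D^N≡1 = subst (λ z → Even (D^ N (binom N) j - + z)) (nC0≡1 j)
              (subst (λ n → Even (D^ N (binom n) j - binom 0 j)) (ℕP.+-identityʳ N) (D^-binom-mod-2 N 0 j))
    regroup : ∀ a b → (a - + 1) + - (a - b) + (+ 1 + + 1) ≡ b + + 1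
    regroup = solve-∀

signSeq : List ℕ → Seq
signSeq ks j = sgn (binSum ks j)

binSum-periodic-mod-2 : ∀ e ks → All (_< 2 ^ e) ks → ∀ j → Even (+ binSum ks j + + binSum ks (j ℕ.+ 2 ^ e))
binSum-periodic-mod-2 e []       []           j = even-0
binSum-periodic-mod-2 e (k ∷ ks) (k<N ∷ ks<N) j =
  subst Even (regroup (binom k j) (+ binSum ks j) (binom k (j ℕ.+ 2 ^ e)) (+ binSum ks (j ℕ.+ 2 ^ e)))
    (∣m∣n⇒∣m+n (binom-periodic-mod-2 e k<N j) (binSum-periodic-mod-2 e ks ks<N j))
  where regroup : ∀ a b a' b' → (a + a') + (b + b') ≡ (a + b) + (a' + b')
        regroup = solve-∀

binSum-∷ʳ : ∀ ks k j → binSum (ks ∷ʳ k) j ≡ binSum ks j ℕ.+ j C k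
binSum-∷ʳ []       k j = ℕP.+-identityʳ (j C k)
binSum-∷ʳ (k' ∷ ks) k j = trans (cong (j C k' ℕ.+_) (binSum-∷ʳ ks k j)) (sym (ℕP.+-assoc (j C k') _ _))

signSeq-antiperiodic : ∀ e ks → All (_< 2 ^ e) ks → Antiperiodic (2 ^ e) (signSeq (ks ∷ʳ 2 ^ e))
signSeq-antiperiodic e ks ks<N j = begin
  sgn (binSum (ks ∷ʳ N) (j ℕ.+ N))  ≡⟨ cong sgn (binSum-∷ʳ ks N (j ℕ.+ N)) ⟩
  sgn (A' ℕ.+ B')                   ≡⟨ sgn-≡-neg-of-odd-sum (A' ℕ.+ B') (A ℕ.+ B) odd ⟩
  - sgn (A ℕ.+ B)                   ≡⟨ cong (λ n → - sgn n) (binSum-∷ʳ ks N j) ⟨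
  - sgn (binSum (ks ∷ʳ N) j)        ∎
  where
    open ≡-Reasoning
    N = 2 ^ e
    A = binSum ks j
    A' = binSum ks (j ℕ.+ N)
    B = j C N
    B' = (j ℕ.+ N) C N
    regroup : ∀ a a' b b' → (a + a') + ((b + b') + + 1) ≡ (a' + b') + (a + b) + + 1
    regroup = solve-∀
    odd : Odd (+ (A' ℕ.+ B') + + (A ℕ.+ B))
    odd = subst Even (regroup (+ A) (+ A') (+ B) (+ B'))
            (∣m∣n⇒∣m+n (binSum-periodic-mod-2 e ks ks<N j) (binom-2^e-antiperiodic-mod-2 e j))

sumTo : (ℕ → ℤ) → ℕ → ℤ
sumTo h zero    = + 0
sumTo h (suc m) = h 0 + sumTo (h ∘ suc) m

sumℤ-map-upTo : ∀ h m → sumℤ (map h (upTo m)) ≡ sumTo h m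
sumℤ-map-upTo h m = trans (cong sumℤ (LP.map-upTo h m)) (sumℤ-applyUpTo h m)
  where
    sumℤ-applyUpTo : ∀ h m → sumℤ (applyUpTo h m) ≡ sumTo h m
    sumℤ-applyUpTo h zero    = refl
    sumℤ-applyUpTo h (suc m) = cong (_+_ (h 0)) (sumℤ-applyUpTo (h ∘ suc) m)

sumTo-cong : ∀ {h k} m → (∀ j → h j ≡ k j) → sumTo h m ≡ sumTo k m
sumTo-cong zero    h≡k = refl
sumTo-cong (suc m) h≡k = cong₂ _+_ (h≡k 0) (sumTo-cong m (h≡k ∘ suc))

sumTo-zero : ∀ h m → (∀ j → j < m → h j ≡ + 0) → sumTo h m ≡ + 0
sumTo-zero h zero    h≡0 = refl
sumTo-zero h (suc m) h≡0 = cong₂ _+_ (h≡0 0 (s≤s z≤n)) (sumTo-zero (h ∘ suc) m (λ j j<m → h≡0 (suc j) (s≤s j<m)))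

sumTo-+ : ∀ h k m → sumTo (λ j → h j + k j) m ≡ sumTo h m + sumTo k m
sumTo-+ h k zero    = refl
sumTo-+ h k (suc m) =
  trans (cong (_+_ (h 0 + k 0)) (sumTo-+ (h ∘ suc) (k ∘ suc) m))
        (regroup (h 0) (k 0) (sumTo (h ∘ suc) m) (sumTo (k ∘ suc) m))
  where regroup : ∀ a b c d → a + b + (c + d) ≡ a + c + (b + d)
        regroup = solve-∀

sumTo-last : ∀ h m → sumTo h (suc m) ≡ sumTo h m + h m
sumTo-last h zero    = ℤP.+-comm (h 0) (+ 0)
sumTo-last h (suc m) = trans (cong (_+_ (h 0)) (sumTo-last (h ∘ suc) m)) (sym (ℤP.+-assoc (h 0) _ _))

binomialTransform : Seq → Seq
binomialTransform u n = sumTo (λ j → u j * + (n C j)) (suc n)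

binomialTransform-suc : ∀ u n → binomialTransform u (suc n) ≡ binomialTransform (D u) n
binomialTransform-suc u n = begin
  binomialTransform u (suc n)                                  ≡⟨ cong₂ _+_ (head (suc n)) (sumTo-cong (suc n) pascal) ⟩
  u 0 + sumTo (λ j → p j + q j) (suc n)                        ≡⟨ cong (_+_ (u 0)) (sumTo-+ p q (suc n)) ⟩
  u 0 + (sumTo p (suc n) + sumTo q (suc n))                    ≡⟨ cong (λ z → u 0 + (sumTo p (suc n) + z)) (sumTo-last q n) ⟩
  u 0 + (sumTo p (suc n) + (sumTo q n + q n))                  ≡⟨ cong (λ z → u 0 + (sumTo p (suc n) + (sumTo q n + z))) q[n]≡0 ⟩
  u 0 + (sumTo p (suc n) + (sumTo q n + + 0))                  ≡⟨ regroup (u 0) (sumTo p (suc n)) (sumTo q n) ⟩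
  (u 0 + sumTo q n) + sumTo p (suc n)                          ≡⟨ cong (λ z → z + sumTo q n + sumTo p (suc n)) (head n) ⟨
  binomialTransform u n + sumTo p (suc n)                      ≡⟨ sumTo-+ (λ j → u j * + (n C j)) p (suc n) ⟨
  sumTo (λ j → u j * + (n C j) + p j) (suc n)                  ≡⟨ sumTo-cong (suc n) distrib ⟨
  binomialTransform (D u) n                                    ∎
  where
    open ≡-Reasoning
    p q : ℕ → ℤ
    p j = u (suc j) * + (n C j)
    q j = u (suc j) * + (n C suc j)
    head : ∀ m → u 0 * + (m C 0) ≡ u 0
    head m = trans (cong (λ z → u 0 * + z) (nC0≡1 m)) (ℤP.*-identityʳ (u 0))
    pascal : ∀ j → u (suc j) * + (suc n C suc j) ≡ p j + q j
    pascal j = trans (cong (λ z → u (suc j) * + z) (sym (nCk+nC[k+1]≡[n+1]C[k+1] n j)))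
                     (ℤP.*-distribˡ-+ (u (suc j)) (+ (n C j)) (+ (n C suc j)))
    distrib : ∀ j → D u j * + (n C j) ≡ u j * + (n C j) + p j
    distrib j = ℤP.*-distribʳ-+ (+ (n C j)) (u j) (u (suc j))
    q[n]≡0 : q n ≡ + 0
    q[n]≡0 = trans (cong (λ z → u (suc n) * + z) (k>n⇒nCk≡0 (ℕP.n<1+n n))) (ℤP.*-zeroʳ (u (suc n)))
    regroup : ∀ a b c → a + (b + (c + + 0)) ≡ (a + c) + b
    regroup = solve-∀

binomialTransform≡D^ : ∀ u n → binomialTransform u n ≡ D^ n u 0
binomialTransform≡D^ u zero    = trans (ℤP.+-identityʳ _) (ℤP.*-identityʳ (u 0))
binomialTransform≡D^ u (suc n) =
  trans (binomialTransform-suc u n) (trans (binomialTransform≡D^ (D u) n) (D^-D n u 0))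

applyUpTo-cong : ∀ {f h : ℕ → ℤ} n → (∀ m → f m ≡ h m) → applyUpTo f n ≡ applyUpTo h n
applyUpTo-cong zero    f≡h = refl
applyUpTo-cong (suc n) f≡h = cong₂ _∷_ (f≡h 0) (applyUpTo-cong n (f≡h ∘ suc))

applyUpTo-⊞ : ∀ (f h : ℕ → ℤ) n → applyUpTo (λ m → f m + h m) n ≡ applyUpTo f n ⊞ applyUpTo h n
applyUpTo-⊞ f h zero    = refl
applyUpTo-⊞ f h (suc n) = cong (f 0 + h 0 ∷_) (applyUpTo-⊞ (f ∘ suc) (h ∘ suc) n)

evalD-∷ʳ-0 : ∀ p u j → evalD (p ∷ʳ + 0) u j ≡ evalD p u j
evalD-∷ʳ-0 p u j = trans (evalD-++ p (+ 0 ∷ []) u j)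
  (trans (cong (_+_ (evalD p u j)) (D^-zero (length p) (λ _ → refl) j)) (ℤP.+-identityʳ _))

binomialCoeff : ℕ → ℕ → ℤ
binomialCoeff n m = sgn m * + (n C m)

binomialPoly : ℕ → List ℤ
binomialPoly n = applyUpTo (binomialCoeff n) (suc n)

shift : (ℕ → ℤ) → ℕ → ℤ
shift a zero    = + 0
shift a (suc m) = a m

binomialCoeff-suc : ∀ n m → binomialCoeff (suc n) m ≡ binomialCoeff n m + - shift (binomialCoeff n) m
binomialCoeff-suc n zero    = cong (λ z → + 1 * + z + - + 0) (trans (nC0≡1 (suc n)) (sym (nC0≡1 n)))
binomialCoeff-suc n (suc m) = begin
  sgn (suc m) * + (suc n C suc m)             ≡⟨ cong (λ z → sgn (suc m) * + z) (sym (nCk+nC[k+1]≡[n+1]C[k+1] n m)) ⟩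
  sgn (suc m) * (+ (n C m) + + (n C suc m))   ≡⟨ cong (λ s → s * (+ (n C m) + + (n C suc m))) (sgn-suc m) ⟩
  - sgn m * (+ (n C m) + + (n C suc m))       ≡⟨ expand (sgn m) (+ (n C m)) (+ (n C suc m)) ⟩
  - sgn m * + (n C suc m) + - a m             ≡⟨ cong (λ s → s * + (n C suc m) + - a m) (sgn-suc m) ⟨
  a (suc m) + - a m                           ∎
  where
    open ≡-Reasoning
    a = binomialCoeff n
    expand : ∀ s x y → - s * (x + y) ≡ - s * y + - (s * x)
    expand = solve-∀

evalD-binomialPoly : ∀ n u j → evalD (binomialPoly n) u j ≡ sgn n * u (j ℕ.+ n)
evalD-binomialPoly zero u j =
  trans (ℤP.+-identityʳ _) (cong (λ i → + 1 * u i) (sym (ℕP.+-identityʳ j)))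
evalD-binomialPoly (suc n) u j = begin
  evalD (binomialPoly (suc n)) u j
    ≡⟨ cong (λ p → evalD p u j) (trans (applyUpTo-cong (suc (suc n)) (binomialCoeff-suc n))
                                       (applyUpTo-⊞ a (λ m → - shift a m) (suc (suc n)))) ⟩
  evalD (applyUpTo a (suc (suc n)) ⊞ applyUpTo (λ m → - shift a m) (suc (suc n))) u j
    ≡⟨ evalD-⊞ (applyUpTo a (suc (suc n))) (applyUpTo (λ m → - shift a m) (suc (suc n))) u j ⟩
  evalD (applyUpTo a (suc (suc n))) u j + evalD (applyUpTo (λ m → - shift a m) (suc (suc n))) u j
    ≡⟨ cong₂ _+_ drop-top negate ⟩
  evalD (binomialPoly n) u j + - (+ 0 * u j + D (evalD (binomialPoly n) u) j)
    ≡⟨ cong₂ (λ x y → x + - (+ 0 * u j + (x + y))) (evalD-binomialPoly n u j) (evalD-binomialPoly n u (suc j)) ⟩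
  sgn n * u (j ℕ.+ n) + - (+ 0 * u j + (sgn n * u (j ℕ.+ n) + sgn n * u (suc j ℕ.+ n)))
    ≡⟨ regroup (sgn n) (u (j ℕ.+ n)) (u (suc j ℕ.+ n)) (u j) ⟩
  - sgn n * u (suc j ℕ.+ n)
    ≡⟨ cong₂ (λ s i → s * u i) (sym (sgn-suc n)) (sym (ℕP.+-suc j n)) ⟩
  sgn (suc n) * u (j ℕ.+ suc n) ∎
  where
    open ≡-Reasoning
    a = binomialCoeff n
    drop-top : evalD (applyUpTo a (suc (suc n))) u j ≡ evalD (binomialPoly n) u j
    drop-top = trans (cong (λ p → evalD p u j) (sym (LP.applyUpTo-∷ʳ a (suc n))))
      (trans (cong (λ z → evalD (binomialPoly n ∷ʳ z) u j) a[n+1]≡0) (evalD-∷ʳ-0 (binomialPoly n) u j))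
      where a[n+1]≡0 : a (suc n) ≡ + 0
            a[n+1]≡0 = trans (cong (λ z → sgn (suc n) * + z) (k>n⇒nCk≡0 (ℕP.n<1+n n))) (ℤP.*-zeroʳ (sgn (suc n)))
    negate : evalD (applyUpTo (λ m → - shift a m) (suc (suc n))) u j ≡ - (+ 0 * u j + D (evalD (binomialPoly n) u) j)
    negate = trans (cong (λ p → evalD p u j) (sym (LP.map-applyUpTo (shift a) -_ (suc (suc n)))))
                   (evalD-neg (applyUpTo (shift a) (suc (suc n))) u j)
    regroup : ∀ s a b x → s * a + - (+ 0 * x + (s * a + s * b)) ≡ - s * b
    regroup = solve-∀

evalD-targetPoly : ∀ r u j → evalD (targetPoly r) u j ≡ u j + sgn (2 ^ (r ℕ.∸ 1)) * u (j ℕ.+ 2 ^ (r ℕ.∸ 1))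
evalD-targetPoly r u j = begin
  + 2 * u j + D (evalD (map a (upTo N)) u) j             ≡⟨ cong (λ p → + 2 * u j + D (evalD p u) j) (LP.map-upTo a N) ⟩
  + 2 * u j + R                                          ≡⟨ split (u j) R ⟩
  u j + (+ 1 * + 1 * u j + R)                            ≡⟨ cong (λ z → u j + (+ 1 * + z * u j + R)) (sym (nC0≡1 N)) ⟩
  u j + evalD (binomialPoly N) u j                       ≡⟨ cong (_+_ (u j)) (evalD-binomialPoly N u j) ⟩
  u j + sgn N * u (j ℕ.+ N)                              ∎
  where
    open ≡-Reasoning
    N = 2 ^ (r ℕ.∸ 1)
    a = binomialCoeff N ∘ suc
    R = D (evalD (applyUpTo a N) u) j
    split : ∀ x y → + 2 * x + y ≡ x + (+ 1 * + 1 * x + y)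
    split = solve-∀

targetPoly-annihilates : ∀ e {u} → Antiperiodic (2 ^ suc e) u → targetPoly (suc (suc e)) annihilates u
targetPoly-annihilates e {u} anti j = begin
  evalD (targetPoly (suc (suc e))) u j  ≡⟨ evalD-targetPoly (suc (suc e)) u j ⟩
  u j + sgn N * u (j ℕ.+ N)              ≡⟨ cong₂ (λ s x → u j + s * x) (sgn-2^suc e) (anti j) ⟩
  u j + + 1 * - u j                      ≡⟨ cancel (u j) ⟩
  + 0                                    ∎
  where
    open ≡-Reasoning
    N = 2 ^ suc e
    cancel : ∀ x → x + + 1 * - x ≡ + 0
    cancel = solve-∀

δ₀ : ℕ → ℤ
δ₀ zero    = + 1
δ₀ (suc _) = + 0

pulse : ℕ → Seq
pulse N' j = sgn (j / suc N') * δ₀ (j % suc N')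

pulse-antiperiodic : ∀ N' → Antiperiodic (suc N') (pulse N')
pulse-antiperiodic N' j = begin
  sgn ((j ℕ.+ N) / N) * δ₀ ((j ℕ.+ N) % N)  ≡⟨ cong₂ (λ a b → sgn a * δ₀ b) quotient remainder ⟩
  sgn (suc (j / N)) * δ₀ (j % N)             ≡⟨ cong (_* δ₀ (j % N)) (sgn-suc (j / N)) ⟩
  - sgn (j / N) * δ₀ (j % N)                 ≡⟨ ℤP.neg-distribˡ-* (sgn (j / N)) (δ₀ (j % N)) ⟨
  - (sgn (j / N) * δ₀ (j % N))               ∎
  where
    open ≡-Reasoning
    N = suc N'
    quotient : (j ℕ.+ N) / N ≡ suc (j / N)
    quotient = trans (ℕD.m/n≡1+[m∸n]/n (ℕP.m≤n+m N j)) (cong (λ z → suc (z / N)) (ℕP.m+n∸n≡m j N))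
    remainder : (j ℕ.+ N) % N ≡ j % N
    remainder = ℕD.[m+n]%n≡m%n j N

D^-pulse : ∀ N' → D^ N' (pulse N') 0 ≡ + 1
D^-pulse N' = trans (sym (binomialTransform≡D^ (pulse N') N'))
  (trans (cong₂ _+_ (cong (λ z → + 1 * + z) (nC0≡1 N')) (sumTo-zero _ N' vanishes)) refl)
  where
    vanishes : ∀ j → j < N' → pulse N' (suc j) * + (N' C suc j) ≡ + 0
    vanishes j j<N' = trans (cong (λ b → sgn (suc j / suc N') * δ₀ b * + (N' C suc j)) (ℕD.m<n⇒m%n≡m (s≤s j<N')))
      (cong (_* + (N' C suc j)) (ℤP.*-zeroʳ (sgn (suc j / suc N'))))

even-D-evalD : ∀ c {u} → (∀ j → Even (D u j)) → ∀ j → Even (D (evalD c u) j)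
even-D-evalD []       even j = even-0
even-D-evalD (c ∷ cs) {u} even j =
  subst Even (regroup c (u j) (u (suc j)) (evalD cs u j) (evalD cs u (suc j)) (evalD cs u (suc (suc j))))
    (∣m∣n⇒∣m+n (∣n⇒∣m*n c (even j)) (∣m∣n⇒∣m+n (even-D-evalD cs even j) (even-D-evalD cs even (suc j))))
  where regroup : ∀ c a b x y z → c * (a + b) + ((x + y) + (y + z)) ≡ (c * a + (x + y)) + (c * b + (y + z))
        regroup = solve-∀

∥_∥ : List ℤ → ℕ
∥ c ∥ = sum (map ∣_∣ c)

∥∥≡0⇒zero : ∀ c → ∥ c ∥ ≡ 0 → All (_≡ + 0) c
∥∥≡0⇒zero []      _  = []
∥∥≡0⇒zero (x ∷ c) ∥c∥≡0 =
  ℤP.∣i∣≡0⇒i≡0 (ℕP.m+n≡0⇒m≡0 ∣ x ∣ ∥c∥≡0) ∷ ∥∥≡0⇒zero c (ℕP.m+n≡0⇒n≡0 ∣ x ∣ ∥c∥≡0)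

∥double∥ : ∀ c → ∥ map (_* + 2) c ∥ ≡ ∥ c ∥ ℕ.+ ∥ c ∥
∥double∥ []      = refl
∥double∥ (x ∷ c) = trans (cong₂ ℕ._+_ (ℤP.abs-* x (+ 2)) (∥double∥ c)) (regroup ∣ x ∣ ∥ c ∥)
  where regroup : ∀ a b → a ℕ.* 2 ℕ.+ (b ℕ.+ b) ≡ (a ℕ.+ b) ℕ.+ (a ℕ.+ b)
        regroup = ℕRing.solve-∀

halve : ∀ {c} → All Even c → Σ (List ℤ) λ h → c ≡ map (_* + 2) h
halve []                   = [] , refl
halve (divides q x≡q*2 ∷ es) with halve es
... | h , c≡2h = q ∷ h , cong₂ _∷_ x≡q*2 c≡2h

m+m≤1+n⇒m≤n : ∀ {m n} → m ℕ.+ m ≤ suc n → m ≤ n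
m+m≤1+n⇒m≤n {zero}  _              = z≤n
m+m≤1+n⇒m≤n {suc m} (s≤s m+1+m≤n) = ℕP.≤-trans (ℕP.m≤n+m (suc m) m) m+1+m≤n

module LowDegreeAnnihilator (e : ℕ) {g : Seq} (g-anti : Antiperiodic (2 ^ suc e) g) (g-odd : ∀ j → Odd (g j)) where

  private
    N N' : ℕ
    N  = 2 ^ suc e
    N' = ℕ.pred N
    suc[N']≡N : suc N' ≡ N
    suc[N']≡N = ℕP.suc-pred N {{ℕP.m^n≢0 2 (suc e)}}

  -- targetPoly (2 + e) is definitionally + 2 ∷ targetTail.
  targetTail : List ℤ
  targetTail = map (binomialCoeff N ∘ suc) (upTo N)

  length-targetTail : length targetTail ≡ N
  length-targetTail = trans (LP.length-map _ (upTo N)) (LP.length-upTo N)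

  double-as-D : ∀ {u} → Antiperiodic N u → ∀ j → + 2 * u j ≡ - D (evalD targetTail u) j
  double-as-D {u} anti j = inverseˡ-unique (+ 2 * u j) (D (evalD targetTail u) j) (targetPoly-annihilates e anti j)

  D-g-even : ∀ j → Even (D g j)
  D-g-even j = subst Even (regroup (g j) (g (suc j)))
    (∣m∣n⇒∣m+n (∣m∣n⇒∣m+n (g-odd j) (g-odd (suc j))) (∣m⇒∣-m (even-double (+ 1))))
    where regroup : ∀ a b → (a + + 1) + (b + + 1) + - (+ 1 + + 1) ≡ a + b
          regroup = solve-∀

  constant-coefficient-even : ∀ c₀ cs → (c₀ ∷ cs) annihilates g → Even c₀
  constant-coefficient-even c₀ cs ann =
    even-*-odd c₀ (subst Even c₀g₀≡ (∣m⇒∣-m (even-D-evalD cs D-g-even 0))) (g-odd 0)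
    where c₀g₀≡ : - D (evalD cs g) 0 ≡ c₀ * g 0
          c₀g₀≡ = sym (inverseˡ-unique (c₀ * g 0) (D (evalD cs g) 0) (ann 0))

  FactorsThroughD : List ℤ → List ℤ → Set
  FactorsThroughD c c' = ∀ u → Antiperiodic N u → ∀ j → evalD c u j ≡ D (evalD c' u) j

  peel : ∀ c → length c ≤ N → c annihilates g →
         Σ (List ℤ) λ c' → length c' ≤ N × c' annihilates g × FactorsThroughD c c'
  peel []         _   _   = [] , z≤n , (λ _ → refl) , (λ _ _ _ → refl)
  peel (c₀ ∷ cs) len ann with constant-coefficient-even c₀ cs ann
  ... | divides q c₀≡q*2 = c' , length-c' , c'-annihilates , factors
    where
      c' = cs ⊞ map (_* - q) targetTail
      length-c' : length c' ≤ N
      length-c' = length-⊞-≤ N cs (map (_* - q) targetTail) (ℕP.≤-trans (ℕP.n≤1+n (length cs)) len)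
        (ℕP.≤-reflexive (trans (LP.length-map (_* - q) targetTail) length-targetTail))
      evalD-c' : ∀ u j → evalD c' u j ≡ evalD cs u j + evalD targetTail u j * - q
      evalD-c' u j = trans (evalD-⊞ cs _ u j) (cong (_+_ (evalD cs u j)) (evalD-scale targetTail (- q) u j))
      factors : FactorsThroughD (c₀ ∷ cs) c'
      factors u anti j = begin
        c₀ * u j + D (evalD cs u) j                   ≡⟨ cong (λ z → z * u j + D (evalD cs u) j) c₀≡q*2 ⟩
        q * + 2 * u j + D (evalD cs u) j              ≡⟨ cong (_+ D (evalD cs u) j) (ℤP.*-assoc q (+ 2) (u j)) ⟩
        q * (+ 2 * u j) + D (evalD cs u) j            ≡⟨ cong (λ z → q * z + D (evalD cs u) j) (double-as-D anti j) ⟩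
        q * - D (evalD targetTail u) j + D (evalD cs u) j
          ≡⟨ regroup q (evalD targetTail u j) (evalD targetTail u (suc j)) (evalD cs u j) (evalD cs u (suc j)) ⟩
        (evalD cs u j + evalD targetTail u j * - q) + (evalD cs u (suc j) + evalD targetTail u (suc j) * - q)
          ≡⟨ cong₂ _+_ (evalD-c' u j) (evalD-c' u (suc j)) ⟨
        D (evalD c' u) j                              ∎
        where
          open ≡-Reasoning
          regroup : ∀ q r r' a a' → q * - (r + r') + (a + a') ≡ (a + r * - q) + (a' + r' * - q)
          regroup = solve-∀
      c'-annihilates : c' annihilates g
      c'-annihilates = D-injective-antiperiodic (2 ^ e) (antiperiodic-evalD c' g-anti)
        (λ j → trans (sym (factors g g-anti j)) (ann j))

  peel-iterate : ∀ k c → length c ≤ N → c annihilates g →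
                 Σ (List ℤ) λ c' → length c' ≤ N × c' annihilates g ×
                   (∀ u → Antiperiodic N u → ∀ j → evalD c u j ≡ D^ k (evalD c' u) j)
  peel-iterate zero    c len ann = c , len , ann , (λ _ _ _ → refl)
  peel-iterate (suc k) c len ann with peel-iterate k c len ann
  ... | c₁ , len₁ , ann₁ , factors₁ with peel c₁ len₁ ann₁
  ... | c₂ , len₂ , ann₂ , factors₂ = c₂ , len₂ , ann₂ , λ u anti j →
        trans (factors₁ u anti j) (trans (D^-cong k (factors₂ u anti) j) (D^-D k (evalD c₂ u) j))

  annihilator-even-on-antiperiodic : ∀ c → length c ≤ N → c annihilates g →
                                     ∀ u → Antiperiodic N u → ∀ j → Even (evalD c u j)
  annihilator-even-on-antiperiodic c len ann u anti j with peel-iterate N c len ann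
  ... | c' , _ , _ , factors =
        subst Even (sym (factors u anti j)) (even-D^-antiperiodic (suc e) (antiperiodic-evalD c' anti) j)

  private
    e₀ : Seq
    e₀ = pulse N'

    e₀-antiperiodic : Antiperiodic N e₀
    e₀-antiperiodic = subst (λ n → Antiperiodic n e₀) suc[N']≡N (pulse-antiperiodic N')

  -- For the lowest odd coefficient cᵢ take m = N - 1 - i: the lower coefficients are even,
  -- cᵢ meets D^(N-1) e₀ 0 = 1, and the higher ones meet D^(≥N) e₀, which is even.
  odd-coefficient-detected : ∀ c → Any (¬_ ∘ Even) c → length c ≤ N →
                             Σ ℕ λ m → N ≤ m ℕ.+ length c × ¬ Even (D^ m (evalD c e₀) 0)
  odd-coefficient-detected (c₀ ∷ cs) odd len with + 2 ∣? c₀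
  ... | no ¬even-c₀ = N' , top-degree , subst (¬_ ∘ Even) (sym (D^-evalD-∷ N' c₀ cs e₀ 0))
          (¬even-+-even (subst (¬_ ∘ Even) (sym (trans (cong (c₀ *_) (D^-pulse N')) (ℤP.*-identityʳ c₀))) ¬even-c₀)
                        (subst (λ n → Even (D^ n (evalD cs e₀) 0)) (sym suc[N']≡N)
                               (even-D^-antiperiodic (suc e) (antiperiodic-evalD cs e₀-antiperiodic) 0)))
    where top-degree : N ≤ N' ℕ.+ length (c₀ ∷ cs)
          top-degree = subst (_≤ N' ℕ.+ suc (length cs)) suc[N']≡N
            (ℕP.≤-trans (s≤s (ℕP.m≤m+n N' (length cs))) (ℕP.≤-reflexive (sym (ℕP.+-suc N' (length cs)))))
  odd-coefficient-detected (c₀ ∷ cs) (here ¬even-c₀) len | yes even-c₀ = ⊥-elim (¬even-c₀ even-c₀)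
  odd-coefficient-detected (c₀ ∷ cs) (there odd) len | yes even-c₀
    with odd-coefficient-detected cs odd (ℕP.≤-trans (ℕP.n≤1+n (length cs)) len)
  ... | zero , N≤len , _ = ⊥-elim (ℕP.<⇒≱ len N≤len)
  ... | suc m , N≤m+len , ¬even =
        m , ℕP.≤-trans N≤m+len (ℕP.≤-reflexive (sym (ℕP.+-suc m (length cs)))) ,
        subst (¬_ ∘ Even) (trans (ℤP.+-comm (D^ (suc m) (evalD cs e₀) 0) (c₀ * D^ m e₀ 0))
                                 (sym (D^-evalD-∷ m c₀ cs e₀ 0)))
          (¬even-+-even ¬even (∣m⇒∣m*n (D^ m e₀ 0) even-c₀))

  annihilator-coefficients-even : ∀ c → length c ≤ N → c annihilates g → All Even c
  annihilator-coefficients-even c len ann with all? (+ 2 ∣?_) c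
  ... | yes all-even = all-even
  ... | no ¬all-even with odd-coefficient-detected c (AllP.¬All⇒Any¬ (+ 2 ∣?_) c ¬all-even) len
  ...   | m , _ , ¬even = ⊥-elim (¬even (even-D^ m (annihilator-even-on-antiperiodic c len ann e₀ e₀-antiperiodic) 0))

  annihilator-zero : ∀ c → length c ≤ N → c annihilates g → All (_≡ + 0) c
  annihilator-zero c = descend ∥ c ∥ c ℕP.≤-refl
    where
      descend : ∀ B c → ∥ c ∥ ≤ B → length c ≤ N → c annihilates g → All (_≡ + 0) c
      descend zero    c ∥c∥≤0 _ _ = ∥∥≡0⇒zero c (ℕP.n≤0⇒n≡0 ∥c∥≤0)
      descend (suc B) c ∥c∥≤1+B len ann with halve (annihilator-coefficients-even c len ann)
      ... | h , refl = AllP.map⁺ (All.map (cong (_* + 2)) (descend B h ∥h∥≤B length-h h-annihilates))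
        where
          ∥h∥≤B : ∥ h ∥ ≤ B
          ∥h∥≤B = m+m≤1+n⇒m≤n (subst (_≤ suc B) (∥double∥ h) ∥c∥≤1+B)
          length-h : length h ≤ N
          length-h = subst (_≤ N) (LP.length-map (_* + 2) h) len
          h-annihilates : h annihilates g
          h-annihilates j = ℤP.*-cancelʳ-≡ (evalD h g j) (+ 0) (+ 2) (trans (sym (evalD-scale h (+ 2) g j)) (ann j))

  annihilator-injective : ∀ p q → length p ≡ length q → length p ≤ N →
                          (∀ j → evalD p g j ≡ evalD q g j) → p ≡ q
  annihilator-injective p q same-length len p≡q-on-g =
    difference-zero p q same-length (annihilator-zero (p ⊞ map -_ q) length-d d-annihilates)
    where
      length-d : length (p ⊞ map -_ q) ≤ N
      length-d = length-⊞-≤ N p (map -_ q) len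
        (subst (_≤ N) (trans same-length (sym (LP.length-map -_ q))) len)
      d-annihilates : (p ⊞ map -_ q) annihilates g
      d-annihilates j = trans (evalD-⊞ p (map -_ q) g j)
        (trans (cong (_+_ (evalD p g j)) (evalD-neg q g j))
        (trans (cong (_- evalD q g j) (p≡q-on-g j)) (ℤP.+-inverseʳ (evalD q g j))))
      difference-zero : ∀ p q → length p ≡ length q → All (_≡ + 0) (p ⊞ map -_ q) → p ≡ q
      difference-zero []      []      _  _          = refl
      difference-zero (x ∷ p) (y ∷ q) same (x-y≡0 ∷ zeros) =
        cong₂ _∷_ (ℤP.i-j≡0⇒i≡j x y x-y≡0) (difference-zero p q (ℕP.suc-injective same) zeros)

combination : List ℤ → (ℕ → ℤ) → ℕ → ℤ
combination []       x n = + 0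
combination (c ∷ cs) x n = c * x n + combination cs x (suc n)

combination-cong : ∀ cs {x y} n → (∀ m → x m ≡ y m) → combination cs x n ≡ combination cs y n
combination-cong []       n x≡y = refl
combination-cong (c ∷ cs) n x≡y = cong₂ (λ a b → c * a + b) (x≡y n) (combination-cong cs (suc n) x≡y)

combination-++ : ∀ p q x n → combination (p ++ q) x n ≡ combination p x n + combination q x (n ℕ.+ length p)
combination-++ []      q x n = trans (cong (combination q x) (sym (ℕP.+-identityʳ n))) (sym (ℤP.+-identityˡ _))
combination-++ (c ∷ p) q x n =
  trans (cong (_+_ (c * x n)) (trans (combination-++ p q x (suc n))
          (cong (λ k → combination p x (suc n) + combination q x k) (sym (ℕP.+-suc n (length p))))))
        (sym (ℤP.+-assoc (c * x n) _ _))

charPolyLower : List ℤ → List ℤ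
charPolyLower b = reverse (map -_ b)

length-charPolyLower : ∀ b → length (charPolyLower b) ≡ length b
length-charPolyLower b = trans (LP.length-reverse (map -_ b)) (LP.length-map -_ b)

combination-charPolyLower : ∀ b x n → combination (charPolyLower b) x n ≡ - recRHS x b (n ℕ.+ length b)
combination-charPolyLower []       x n = refl
combination-charPolyLower (c ∷ cs) x n = begin
  combination (reverse (map -_ (c ∷ cs))) x n
    ≡⟨ cong (λ p → combination p x n) (LP.unfold-reverse (- c) (map -_ cs)) ⟩
  combination (charPolyLower cs ++ (- c ∷ [])) x n
    ≡⟨ combination-++ (charPolyLower cs) (- c ∷ []) x n ⟩
  combination (charPolyLower cs) x n + (- c * x (n ℕ.+ length (charPolyLower cs)) + + 0)
    ≡⟨ cong₂ (λ a i → a + (- c * x i + + 0)) (combination-charPolyLower cs x n) (cong (n ℕ.+_) (length-charPolyLower cs)) ⟩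
  - R + (- c * X + + 0)
    ≡⟨ regroup c R X ⟩
  - (c * X + R)
    ≡⟨ cong (λ k → - (c * x (k ∸ 1) + recRHS x cs (k ∸ 1))) (sym (ℕP.+-suc n (length cs))) ⟩
  - recRHS x (c ∷ cs) (n ℕ.+ length (c ∷ cs)) ∎
  where
    open ≡-Reasoning
    R = recRHS x cs (n ℕ.+ length cs)
    X = x (n ℕ.+ length cs)
    regroup : ∀ c R X → - R + (- c * X + + 0) ≡ - (c * X + R)
    regroup = solve-∀

combination-charPoly : ∀ b x n → combination (charPoly b) x n ≡ x (n ℕ.+ length b) - recRHS x b (n ℕ.+ length b)
combination-charPoly b x n = begin
  combination (charPolyLower b ++ (+ 1 ∷ [])) x n
    ≡⟨ combination-++ (charPolyLower b) (+ 1 ∷ []) x n ⟩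
  combination (charPolyLower b) x n + (+ 1 * x (n ℕ.+ length (charPolyLower b)) + + 0)
    ≡⟨ cong₂ (λ a i → a + (+ 1 * x i + + 0)) (combination-charPolyLower b x n) (cong (n ℕ.+_) (length-charPolyLower b)) ⟩
  - R + (+ 1 * X + + 0)
    ≡⟨ regroup R X ⟩
  X - R ∎
  where
    open ≡-Reasoning
    R = recRHS x b (n ℕ.+ length b)
    X = x (n ℕ.+ length b)
    regroup : ∀ R X → - R + (+ 1 * X + + 0) ≡ X - R
    regroup = solve-∀

satisfies⇒combination≡0 : ∀ {x b} → Satisfies x b → ∀ n → 1 ≤ n → combination (charPoly b) x n ≡ + 0
satisfies⇒combination≡0 {x} {b} sat n 1≤n =
  trans (combination-charPoly b x n)
        (trans (cong (_- recRHS x b (n ℕ.+ length b)) (sat n 1≤n)) (ℤP.+-inverseʳ (recRHS x b (n ℕ.+ length b))))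

combination≡0⇒satisfies : ∀ {x b} → (∀ n → 1 ≤ n → combination (charPoly b) x n ≡ + 0) → Satisfies x b
combination≡0⇒satisfies {x} {b} comb≡0 n 1≤n =
  ℤP.i-j≡0⇒i≡j _ _ (trans (sym (combination-charPoly b x n)) (comb≡0 n 1≤n))

combination-orbit : ∀ c u n → combination c (λ m → D^ m u 0) n ≡ D^ n (evalD c u) 0
combination-orbit []       u n = sym (D^-zero n (λ _ → refl) 0)
combination-orbit (c ∷ cs) u n =
  trans (cong (_+_ (c * D^ n u 0)) (combination-orbit cs u (suc n))) (sym (D^-evalD-∷ n c cs u 0))

below-last : ∀ {xs : List ℕ} {y} → AllPairs _<_ (xs ∷ʳ y) → All (_< y) xs
below-last {[]}     _             = []
below-last {x ∷ xs} (x<rest ∷ ps) = proj₂ (AllP.∷ʳ⁻ x<rest) ∷ below-last ps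

charPoly-neg-reverse : ∀ X → charPoly (map -_ (reverse X)) ≡ X ∷ʳ + 1
charPoly-neg-reverse X = cong (_++ (+ 1 ∷ [])) (begin
  reverse (map -_ (map -_ (reverse X)))  ≡⟨ cong reverse (LP.map-∘ (reverse X)) ⟨
  reverse (map (λ z → - - z) (reverse X)) ≡⟨ cong reverse (LP.map-cong ℤP.neg-involutive (reverse X)) ⟩
  reverse (map (λ z → z) (reverse X))    ≡⟨ cong reverse (LP.map-id (reverse X)) ⟩
  reverse (reverse X)                    ≡⟨ LP.reverse-involutive X ⟩
  X                                      ∎)
  where open ≡-Reasoning

length-charPoly : ∀ b → length (charPoly b) ≡ suc (length b)
length-charPoly b = trans (LP.length-++ (charPolyLower b))
  (trans (cong (ℕ._+ 1) (length-charPolyLower b)) (ℕP.+-comm (length b) 1))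

module MinimalRecurrence (e : ℕ) (ks' : List ℕ) (sorted : Linked _<_ (ks' ∷ʳ 2 ^ suc e)) where

  private
    N N' : ℕ
    N  = 2 ^ suc e
    N' = ℕ.pred N
    suc[N']≡N : suc N' ≡ N
    suc[N']≡N = ℕP.suc-pred N {{ℕP.m^n≢0 2 (suc e)}}
    ks = ks' ∷ʳ N
    g = signSeq ks
    g-anti : Antiperiodic N g
    g-anti = signSeq-antiperiodic (suc e) ks' (below-last (Linked⇒AllPairs ℕP.<-trans sorted))

  open LowDegreeAnnihilator e g-anti (λ j → sgn-odd (binSum ks j))

  combination-S : ∀ c n → combination c (S ks) n ≡ D^ n (evalD c g) 0
  combination-S c n = trans (combination-cong c n S≡orbit) (combination-orbit c g n)
    where S≡orbit : ∀ m → S ks m ≡ D^ m g 0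
          S≡orbit m = trans (sumℤ-map-upTo (λ j → g j * + (m C j)) (suc m)) (binomialTransform≡D^ g m)

  annihilates⇒satisfies : ∀ b → charPoly b annihilates g → Satisfies (S ks) b
  annihilates⇒satisfies b ann = combination≡0⇒satisfies {S ks} {b} λ n _ →
    trans (combination-S (charPoly b) n) (D^-zero n ann 0)

  satisfies⇒annihilates : ∀ b → Satisfies (S ks) b → charPoly b annihilates g
  satisfies⇒annihilates b sat = D-injective-antiperiodic (2 ^ e) (antiperiodic-evalD (charPoly b) g-anti)
    (D^-at-0≡0⇒≡0 (D w) λ m → trans (D^-D m w 0)
      (trans (sym (combination-S (charPoly b) (suc m))) (satisfies⇒combination≡0 {S ks} {b} sat (suc m) (s≤s z≤n))))
    where w = evalD (charPoly b) g

  order-lower-bound : ∀ b → Satisfies (S ks) b → N ≤ length b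
  order-lower-bound b sat with N ℕ.≤? length b
  ... | yes N≤b = N≤b
  ... | no  N≰b = ⊥-elim (leading-coefficient≢0 (AllP.++⁻ʳ (charPolyLower b)
                             (annihilator-zero (charPoly b) short (satisfies⇒annihilates b sat))))
    where
      short : length (charPoly b) ≤ N
      short = subst (_≤ N) (sym (length-charPoly b)) (ℕP.≰⇒> N≰b)
      leading-coefficient≢0 : ¬ All (_≡ + 0) (+ 1 ∷ [])
      leading-coefficient≢0 (() ∷ _)

  private
    lowerTarget : List ℤ
    lowerTarget = + 2 ∷ applyUpTo (binomialCoeff N ∘ suc) N'

  recurrence₀ : List ℤ
  recurrence₀ = map -_ (reverse lowerTarget)

  charPoly-recurrence₀ : charPoly recurrence₀ ≡ targetPoly (suc (suc e))
  charPoly-recurrence₀ = trans (charPoly-neg-reverse lowerTarget) (cong (+ 2 ∷_) (sym (begin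
    map a (upTo N)                 ≡⟨ LP.map-upTo a N ⟩
    applyUpTo a N                  ≡⟨ cong (applyUpTo a) suc[N']≡N ⟨
    applyUpTo a (suc N')           ≡⟨ LP.applyUpTo-∷ʳ a N' ⟨
    applyUpTo a N' ∷ʳ a N'         ≡⟨ cong (applyUpTo a N' ∷ʳ_) leading≡1 ⟩
    applyUpTo a N' ∷ʳ + 1          ∎)))
    where
      open ≡-Reasoning
      a = binomialCoeff N ∘ suc
      leading≡1 : a N' ≡ + 1
      leading≡1 = trans (cong (λ n → sgn n * + (N C n)) suc[N']≡N)
                        (cong₂ (λ s c → s * + c) (sgn-2^suc e) (nCn≡1 N))

  length-recurrence₀ : length recurrence₀ ≡ N
  length-recurrence₀ = trans (LP.length-map -_ (reverse lowerTarget)) (trans (LP.length-reverse lowerTarget)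
    (trans (cong suc (LP.length-applyUpTo (binomialCoeff N ∘ suc) N')) suc[N']≡N))

  recurrence₀-satisfied : Satisfies (S ks) recurrence₀
  recurrence₀-satisfied = annihilates⇒satisfies recurrence₀
    (subst (_annihilates g) (sym charPoly-recurrence₀) (targetPoly-annihilates e g-anti))

  recurrence₀-minimal : IsMinimalRecurrence (S ks) recurrence₀
  recurrence₀-minimal = recurrence₀-satisfied , λ b sat →
    subst (_≤ length b) (sym length-recurrence₀) (order-lower-bound b sat)

  minimal-charPoly-unique : ∀ a → IsMinimalRecurrence (S ks) a → charPoly a ≡ targetPoly (suc (suc e))
  minimal-charPoly-unique a (sat , minimal) = trans (cong (_++ (+ 1 ∷ [])) same-lower) charPoly-recurrence₀
    where
      length-a : length a ≡ N
      length-a = ℕP.≤-antisym (subst (length a ≤_) length-recurrence₀ (minimal recurrence₀ recurrence₀-satisfied))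
                              (order-lower-bound a sat)
      evalD-lower : ∀ b → length b ≡ N → Satisfies (S ks) b →
                    ∀ j → evalD (charPolyLower b) g j ≡ - D^ N (evalD (+ 1 ∷ []) g) j
      evalD-lower b length-b sat j = inverseˡ-unique _ _
        (trans (cong (λ n → evalD (charPolyLower b) g j + D^ n (evalD (+ 1 ∷ []) g) j)
                     (sym (trans (length-charPolyLower b) length-b)))
               (trans (sym (evalD-++ (charPolyLower b) (+ 1 ∷ []) g j)) (satisfies⇒annihilates b sat j)))
      same-lower : charPolyLower a ≡ charPolyLower recurrence₀
      same-lower = annihilator-injective (charPolyLower a) (charPolyLower recurrence₀)
        (trans (length-charPolyLower a) (trans length-a (sym (trans (length-charPolyLower recurrence₀) length-recurrence₀))))
        (ℕP.≤-reflexive (trans (length-charPolyLower a) length-a))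
        (λ j → trans (evalD-lower a length-a sat j)
                     (sym (evalD-lower recurrence₀ length-recurrence₀ recurrence₀-satisfied j)))

mainTheorem7 : (r : ℕ) → 2 ≤ r → (ks' : List ℕ) →
    All (1 ≤_) (ks' ∷ʳ (2 ^ (r ∸ 1))) →
    Linked _<_ (ks' ∷ʳ (2 ^ (r ∸ 1))) →
    Σ (List ℤ) (λ a → IsMinimalRecurrence (S (ks' ∷ʳ (2 ^ (r ∸ 1)))) a)
    × ((a : List ℤ) → IsMinimalRecurrence (S (ks' ∷ʳ (2 ^ (r ∸ 1)))) a →
        charPoly a ≡ targetPoly r)
mainTheorem7 (suc (suc e)) (s≤s (s≤s z≤n)) ks' _ sorted =
  (recurrence₀ , recurrence₀-minimal) , minimal-charPoly-unique
  where open MinimalRecurrence e ks' sorted
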